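{- Let $\Gamma$ be a locally semicomplete commutative weakly distance-regular digraph with $3\in T$. Suppose $\Gamma_{2,i}\in\Gamma_{1,2}\Gamma_{1,q}$ with $i>1$ and $q>0$. If $(1,2)$ is pure, then $i=2$ and $q\in\{2,3\}$.
   Context: Digraphs are finite with arcs being ordered pairs of distinct vertices; $N^\pm(x)$ out-/in-neighbourhoods; circuits of length $r$ are paths $(w_0,\dots,w_{r-1})$ with $(w_{r-1},w_0)$ an arc; $\partial$ distance, $\tilde\partial(x,y)=(\partial(x,y),\partial(y,x))$, $\tilde\partial(\Gamma)$ its value set. Weakly distance-regular: strongly connected and the number $p^{\tilde h}_{\tilde i,\tilde j}$ of $z$ with $\tilde\partial(x,z)=\tilde i$, $\tilde\partial(z,y)=\tilde j$ depends only on $\tilde h=\tilde\partial(x,y)$; commutative: $p^{\tilde h}_{\tilde i,\tilde j}=p^{\tilde h}_{\tilde j,\tilde i}$. Locally semicomplete: each $N^+(x)$, $N^-(x)$ induces a digraph in which any two distinct vertices are joined by at least one arc. $\Gamma_{a,b}$ is the set of pairs with two-way distance $(a,b)$. An arc $(x,y)$ has type $(1,r)$ if $\partial(y,x)=r$; $T=\{q:(1,q-1)\in\tilde\partial(\Gamma)\}$. $(1,2)$ is pure if every circuit of length $3$ containing an arc of type $(1,2)$ consists of arcs of type $(1,2)$. $\Gamma_{\tilde i}\Gamma_{\tilde j}=\{\Gamma_{\tilde h}:p^{\tilde h}_{\tilde i,\tilde j}\neq0\}$. -}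

module Defs where

open import Data.Nat using (ℕ; zero; suc; _≡ᵇ_)
open import Data.Bool using (Bool; true; false; _∧_; if_then_else_)
open import Data.Fin using (Fin)
open import Data.Fin.Properties using (_≟_)
open import Data.List using (List; filterᵇ; length; allFin)
open import Data.Bool.ListAction using (any)
open import Data.Product using (_×_; _,_; ∃; ∃-syntax)
open import Data.Sum using (_⊎_)
open import Relation.Nullary using (¬_)
open import Relation.Nullary.Decidable using (⌊_⌋)
open import Relation.Binary.PropositionalEquality using (_≡_)

record Digraph (n : ℕ) : Set where
  field
    arc    : Fin n → Fin n → Bool
    irrefl : ∀ x → arc x x ≡ false

module _ {n : ℕ} (Γ : Digraph n) where
  open Digraph Γ

  walkB : ℕ → Fin n → Fin n → Bool
  walkB zero    x y = ⌊ x ≟ y ⌋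
  walkB (suc k) x y = any (λ z → arc x z ∧ walkB k z y) (allFin n)

  leastWalk : ℕ → ℕ → Fin n → Fin n → ℕ
  leastWalk zero       k x y = k
  leastWalk (suc fuel) k x y =
    if walkB k x y then k else leastWalk fuel (suc k) x y

  -- In a digraph with n vertices a shortest path has length < n, so
  -- searching lengths 0 .. n-1 is exhaustive (value n only if unreachable).
  ∂ : Fin n → Fin n → ℕ
  ∂ x y = leastWalk n 0 x y

  ∂̃ : Fin n → Fin n → ℕ × ℕ
  ∂̃ x y = ∂ x y , ∂ y x

  InValueSet : ℕ × ℕ → Set
  InValueSet h = ∃[ x ] ∃[ y ] ∂̃ x y ≡ h

  eqPairᵇ : ℕ × ℕ → ℕ × ℕ → Bool
  eqPairᵇ (a , b) (c , d) = (a ≡ᵇ c) ∧ (b ≡ᵇ d)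

  pCount : Fin n → Fin n → ℕ × ℕ → ℕ × ℕ → ℕ
  pCount x y i j =
    length (filterᵇ (λ z → eqPairᵇ (∂̃ x z) i ∧ eqPairᵇ (∂̃ z y) j) (allFin n))

  StronglyConnected : Set
  StronglyConnected = ∀ x y → ∃[ k ] walkB k x y ≡ true

  WeaklyDistanceRegular : Set
  WeaklyDistanceRegular =
    StronglyConnected ×
    (∀ x y x' y' i j → ∂̃ x y ≡ ∂̃ x' y' → pCount x y i j ≡ pCount x' y' i j)

  Commutative : Set
  Commutative = ∀ x y i j → pCount x y i j ≡ pCount x y j i

  LocallySemicomplete : Set
  LocallySemicomplete =
    (∀ x u v → ¬ u ≡ v → arc x u ≡ true → arc x v ≡ true →
       (arc u v ≡ true ⊎ arc v u ≡ true)) ×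
    (∀ x u v → ¬ u ≡ v → arc u x ≡ true → arc v x ≡ true →
       (arc u v ≡ true ⊎ arc v u ≡ true))

  -- q ∈ T  iff  (1, q-1) ∈ ∂̃(Γ)
  InT : ℕ → Set
  InT zero    = InValueSet (1 , 0)
  InT (suc q) = InValueSet (1 , q)

  Type12 : Fin n → Fin n → Set
  Type12 x y = arc x y ≡ true × ∂ y x ≡ 2

  Circuit3 : Fin n → Fin n → Fin n → Set
  Circuit3 w₀ w₁ w₂ =
    ¬ w₀ ≡ w₁ × ¬ w₁ ≡ w₂ × ¬ w₀ ≡ w₂ ×
    arc w₀ w₁ ≡ true × arc w₁ w₂ ≡ true × arc w₂ w₀ ≡ true

  Pure12 : Set
  Pure12 = ∀ w₀ w₁ w₂ → Circuit3 w₀ w₁ w₂ →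
    (Type12 w₀ w₁ ⊎ Type12 w₁ w₂ ⊎ Type12 w₂ w₀) →
    (Type12 w₀ w₁ × Type12 w₁ w₂ × Type12 w₂ w₀)

  -- Γ_h ∈ Γ_i Γ_j : h ∈ ∂̃(Γ) and p^h_{i,j} ≠ 0
  InProduct : ℕ × ℕ → ℕ × ℕ → ℕ × ℕ → Set
  InProduct h i j = ∃[ x ] ∃[ y ] (∂̃ x y ≡ h × ¬ pCount x y i j ≡ 0)

{-# OPTIONS --safe #-}
-- Pick z with ∂̃(x,z) = (1,2) and ∂̃(z,y) = (1,q), and a shortest path z → w → x.
-- As ∂(x,y) = 2 and ∂(y,x) > 1, the vertices x and y are non-adjacent, so by
-- local semicompleteness they have no common out- or in-neighbour.  Now y and w
-- are out-neighbours of z, hence adjacent, and w → y would make w a common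
-- in-neighbour of x and y; so y → w → x → z, giving i ≤ 2 and q ≤ 3.  Finally
-- q = 1 would make z a common out-neighbour of x and y.
module Submission where

open import Defs
open import Data.Nat using (ℕ; zero; suc; _>_; _≤_; _<_; _+_; z≤n; s≤s)
open import Data.Nat.Properties
  using (≤-refl; ≤-trans; ≤-antisym; ≤∧≢⇒<; <⇒≱; n≤1+n; n≮n; +-suc; +-identityʳ; ≡ᵇ⇒≡)
open import Data.Bool using (Bool; true; false; _∧_)
open import Data.Bool.Properties using (T-≡)
open import Data.Fin using (Fin; zero; suc)
open import Data.List using ([]; _∷_; filterᵇ; length; allFin)
open import Data.List.Membership.Propositional using (_∈_; lose)
open import Data.List.Membership.Propositional.Properties using (∈-allFin; ∈-filter⁻)
open import Data.List.Relation.Unary.Any using (here; satisfied)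
open import Data.List.Relation.Unary.Any.Properties using (any⁺; any⁻)
open import Data.Product using (_×_; _,_; ∃-syntax; proj₁; proj₂)
open import Data.Product.Properties using (,-injective)
open import Data.Sum using (_⊎_; inj₁; inj₂)
open import Function using (_∘_)
open import Function.Bundles using (module Equivalence)
open import Relation.Nullary using (¬_; contradiction)
open import Relation.Nullary.Decidable using (T?; toWitness; fromWitness)
open import Relation.Binary.PropositionalEquality using (_≡_; _≢_; refl; sym; trans; subst; cong₂; ≢-sym)

open Equivalence using (to; from)

∧-≡-true⁻ : ∀ {a b} → a ∧ b ≡ true → a ≡ true × b ≡ true
∧-≡-true⁻ {true}  {true}  _ = refl , refl
∧-≡-true⁻ {true}  {false} ()
∧-≡-true⁻ {false} ()

∧-≡-true⁺ : ∀ {a b} → a ≡ true → b ≡ true → a ∧ b ≡ true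
∧-≡-true⁺ refl refl = refl

filterᵇ-nonempty⇒∃ : ∀ {A : Set} (p : A → Bool) xs → length (filterᵇ p xs) ≢ 0 → ∃[ a ] p a ≡ true
filterᵇ-nonempty⇒∃ p xs nonempty with filterᵇ p xs in eq
... | []    = contradiction refl nonempty
... | a ∷ _ = a , to T-≡ (proj₂ (∈-filter⁻ (T? ∘ p) {xs = xs} (subst (a ∈_) (sym eq) (here refl))))

eqPairᵇ-sound : ∀ {n} (Γ : Digraph n) {a b : ℕ × ℕ} → eqPairᵇ Γ a b ≡ true → a ≡ b
eqPairᵇ-sound Γ {a₁ , a₂} {b₁ , b₂} eq with a₁≡b₁ , a₂≡b₂ ← ∧-≡-true⁻ eq =
  cong₂ _,_ (≡ᵇ⇒≡ a₁ b₁ (from T-≡ a₁≡b₁)) (≡ᵇ⇒≡ a₂ b₂ (from T-≡ a₂≡b₂))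

1<m≤3⇒m≡2⊎m≡3 : ∀ {m} → 1 < m → m ≤ 3 → m ≡ 2 ⊎ m ≡ 3
1<m≤3⇒m≡2⊎m≡3 {1} (s≤s ()) _
1<m≤3⇒m≡2⊎m≡3 {2} _ _ = inj₁ refl
1<m≤3⇒m≡2⊎m≡3 {3} _ _ = inj₂ refl
1<m≤3⇒m≡2⊎m≡3 {suc (suc (suc (suc _)))} _ (s≤s (s≤s (s≤s ())))

distinct³⇒2<n : ∀ {n} {a b c : Fin n} → a ≢ b → b ≢ c → a ≢ c → 2 < n
distinct³⇒2<n {suc (suc (suc _))} _ _ _ = s≤s (s≤s (s≤s z≤n))
distinct³⇒2<n {1} {zero} {zero} a≢b _ _ = contradiction refl a≢b
distinct³⇒2<n {2} {zero}  {zero}  a≢b _ _ = contradiction refl a≢b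
distinct³⇒2<n {2} {suc zero} {suc zero} a≢b _ _ = contradiction refl a≢b
distinct³⇒2<n {2} {zero}  {suc zero} {zero}  _ _ a≢c = contradiction refl a≢c
distinct³⇒2<n {2} {zero}  {suc zero} {suc zero} _ b≢c _ = contradiction refl b≢c
distinct³⇒2<n {2} {suc zero} {zero} {zero}  _ b≢c _ = contradiction refl b≢c
distinct³⇒2<n {2} {suc zero} {zero} {suc zero} _ _ a≢c = contradiction refl a≢c

module _ {n : ℕ} (Γ : Digraph n) where
  open Digraph Γ

  private variable
    x y z : Fin n
    j k : ℕ

  Adjacent : Fin n → Fin n → Set
  Adjacent u v = arc u v ≡ true ⊎ arc v u ≡ true

  data Walk : ℕ → Fin n → Fin n → Set where
    []  : Walk 0 x x
    _∷_ : arc x y ≡ true → Walk k y z → Walk (suc k) x z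

  walkB⇒Walk : ∀ k → walkB Γ k x y ≡ true → Walk k x y
  walkB⇒Walk zero w with refl ← toWitness (from T-≡ w) = []
  walkB⇒Walk {x = x} {y = y} (suc k) w
    with z , step ← satisfied (any⁻ (λ z → arc x z ∧ walkB Γ k z y) (allFin n) (from T-≡ w))
    with x→z , z⇝y ← ∧-≡-true⁻ (to T-≡ step)
    = x→z ∷ walkB⇒Walk k z⇝y

  Walk⇒walkB : Walk k x y → walkB Γ k x y ≡ true
  Walk⇒walkB [] = to T-≡ (fromWitness refl)
  Walk⇒walkB {k = suc k} {x = x} {y = y} (x→z ∷ z⇝y) =
    to T-≡ (any⁺ (λ z → arc x z ∧ walkB Γ k z y)
                 (lose (∈-allFin _) (from T-≡ (∧-≡-true⁺ x→z (Walk⇒walkB z⇝y)))))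

  leastWalk-≤ : ∀ fuel → k ≤ j → walkB Γ j x y ≡ true → leastWalk Γ fuel k x y ≤ j
  leastWalk-≤ zero k≤j w = k≤j
  leastWalk-≤ {k = k} {x = x} {y = y} (suc fuel) k≤j w with walkB Γ k x y in e
  ... | true  = k≤j
  ... | false = leastWalk-≤ fuel (≤∧≢⇒< k≤j λ { refl → contradiction (trans (sym w) e) λ () }) w

  leastWalk-walk : ∀ fuel k → leastWalk Γ fuel k x y < k + fuel →
                   walkB Γ (leastWalk Γ fuel k x y) x y ≡ true
  leastWalk-walk zero k lt = contradiction (subst (k <_) (+-identityʳ k) lt) (n≮n k)
  leastWalk-walk {x = x} {y = y} (suc fuel) k lt with walkB Γ k x y in e
  ... | true  = e
  ... | false =
    leastWalk-walk fuel (suc k) (subst (leastWalk Γ fuel (suc k) x y <_) (+-suc k fuel) lt)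

  ∂-minimal : Walk j x y → ∂ Γ x y ≤ j
  ∂-minimal = leastWalk-≤ n z≤n ∘ Walk⇒walkB

  ∂≡⇒Walk : k < n → ∂ Γ x y ≡ k → Walk k x y
  ∂≡⇒Walk k<n refl = walkB⇒Walk _ (leastWalk-walk n 0 k<n)

  ∂≡suc⇒≢ : ∂ Γ x y ≡ suc k → x ≢ y
  ∂≡suc⇒≢ ∂xy refl with () ← subst (_≤ 0) ∂xy (∂-minimal [])

  1<∂⇒¬arc : 1 < ∂ Γ x y → ¬ arc x y ≡ true
  1<∂⇒¬arc 1<∂ x→y = <⇒≱ 1<∂ (∂-minimal (x→y ∷ []))

  InProduct⇒intermediate : ∀ {h i j} → InProduct Γ h i j →
                           ∃[ x ] ∃[ y ] ∃[ z ] ∂̃ Γ x y ≡ h × ∂̃ Γ x z ≡ i × ∂̃ Γ z y ≡ j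
  InProduct⇒intermediate (x , y , ∂̃xy , p≢0)
    with z , z∈ ← filterᵇ-nonempty⇒∃ _ (allFin n) p≢0
    with ∂̃xz , ∂̃zy ← ∧-≡-true⁻ z∈
    = x , y , z , ∂̃xy , eqPairᵇ-sound Γ ∂̃xz , eqPairᵇ-sound Γ ∂̃zy

module _ {n : ℕ} (Γ : Digraph n) (lsc : LocallySemicomplete Γ) where
  open Digraph Γ

  private variable u v w z : Fin n

  no-common-out-neighbour : u ≢ v → ¬ Adjacent Γ u v → arc u w ≡ true → ¬ arc v w ≡ true
  no-common-out-neighbour u≢v u≁v uw vw = u≁v (proj₂ lsc _ _ _ u≢v uw vw)

  no-common-in-neighbour : u ≢ v → ¬ Adjacent Γ u v → arc w u ≡ true → ¬ arc w v ≡ true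
  no-common-in-neighbour u≢v u≁v wu wv = u≁v (proj₁ lsc _ _ _ u≢v wu wv)

  closing-arc : u ≢ v → ¬ Adjacent Γ u v →
                arc z v ≡ true → arc z w ≡ true → arc w u ≡ true → arc v w ≡ true
  closing-arc {u} {v} {z} {w} u≢v u≁v zv zw wu
    with proj₁ lsc z v w (λ { refl → u≁v (inj₂ wu) }) zv zw
  ... | inj₁ vw = vw
  ... | inj₂ wv = contradiction wv (no-common-in-neighbour u≢v u≁v wu)

module Γ₂ᵢ∈Γ₁₂Γ₁q {n : ℕ} (Γ : Digraph n) (lsc : LocallySemicomplete Γ) {x y z : Fin n}
  (∂xy≡2 : ∂ Γ x y ≡ 2) (1<∂yx : 1 < ∂ Γ y x)
  (∂xz≡1 : ∂ Γ x z ≡ 1) (∂zx≡2 : ∂ Γ z x ≡ 2) (∂zy≡1 : ∂ Γ z y ≡ 1) where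
  open Digraph Γ

  x≢y : x ≢ y
  x≢y = ∂≡suc⇒≢ Γ ∂xy≡2

  x≁y : ¬ Adjacent Γ x y
  x≁y (inj₁ x→y) = 1<∂⇒¬arc Γ (subst (1 <_) (sym ∂xy≡2) ≤-refl) x→y
  x≁y (inj₂ y→x) = 1<∂⇒¬arc Γ 1<∂yx y→x

  -- ∂ Γ u v ≡ n encodes unreachability, so reading a walk off a distance k
  -- needs k < n; the three distinct vertices x, z, y give this for k ≤ 2.
  2<n : 2 < n
  2<n = distinct³⇒2<n (∂≡suc⇒≢ Γ ∂xz≡1) (∂≡suc⇒≢ Γ ∂zy≡1) x≢y

  ∂≡1⇒arc : ∀ {u v} → ∂ Γ u v ≡ 1 → arc u v ≡ true
  ∂≡1⇒arc ∂uv≡1 with u→v ∷ [] ← ∂≡⇒Walk Γ (≤-trans (n≤1+n 2) 2<n) ∂uv≡1 = u→v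

  x→z : arc x z ≡ true
  x→z = ∂≡1⇒arc ∂xz≡1

  z→y : arc z y ≡ true
  z→y = ∂≡1⇒arc ∂zy≡1

  y→w→x : ∃[ w ] arc y w ≡ true × arc w x ≡ true
  y→w→x with z→w ∷ w→x ∷ [] ← ∂≡⇒Walk Γ 2<n ∂zx≡2 =
    _ , closing-arc Γ lsc x≢y x≁y z→y z→w w→x , w→x

  ∂yx≤2 : ∂ Γ y x ≤ 2
  ∂yx≤2 with _ , y→w , w→x ← y→w→x = ∂-minimal Γ (y→w ∷ w→x ∷ [])

  ∂yz≤3 : ∂ Γ y z ≤ 3
  ∂yz≤3 with _ , y→w , w→x ← y→w→x = ∂-minimal Γ (y→w ∷ w→x ∷ x→z ∷ [])

  ∂yz≢1 : ∂ Γ y z ≢ 1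
  ∂yz≢1 ∂yz≡1 = no-common-out-neighbour Γ lsc x≢y x≁y x→z (∂≡1⇒arc ∂yz≡1)

  ∂yx≡2×∂yz∈23 : 0 < ∂ Γ y z → ∂ Γ y x ≡ 2 × (∂ Γ y z ≡ 2 ⊎ ∂ Γ y z ≡ 3)
  ∂yx≡2×∂yz∈23 0<∂yz =
    ≤-antisym ∂yx≤2 1<∂yx , 1<m≤3⇒m≡2⊎m≡3 (≤∧≢⇒< 0<∂yz (≢-sym ∂yz≢1)) ∂yz≤3

lemma2p10 : (n : ℕ) (Γ : Digraph n) →
    LocallySemicomplete Γ → WeaklyDistanceRegular Γ → Commutative Γ →
    InT Γ 3 →
    (i q : ℕ) → i > 1 → q > 0 →
    InProduct Γ (2 , i) (1 , 2) (1 , q) →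
    Pure12 Γ →
    i ≡ 2 × (q ≡ 2 ⊎ q ≡ 3)
lemma2p10 n Γ lsc _ _ _ i q i>1 q>0 Γ₂ᵢ∈Γ₁₂Γ₁q _
  with x , y , z , ∂̃xy , ∂̃xz , ∂̃zy ← InProduct⇒intermediate Γ Γ₂ᵢ∈Γ₁₂Γ₁q
  with ∂xy≡2 , refl ← ,-injective ∂̃xy
  with ∂xz≡1 , ∂zx≡2 ← ,-injective ∂̃xz
  with ∂zy≡1 , refl ← ,-injective ∂̃zy
  = Γ₂ᵢ∈Γ₁₂Γ₁q.∂yx≡2×∂yz∈23 Γ lsc ∂xy≡2 i>1 ∂xz≡1 ∂zx≡2 ∂zy≡1 q>0
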